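{- Let $\sigma$ be a System T type, $f:\mathbb{N}\to\mathcal{B}[\![\sigma]\!]$, $n\in\mathcal{D}_{\mathbb N}\mathbb{N}$, and let $g$ and $m$ be families assigning to each System T type $A$ closed terms $g_A:\iota\Rightarrow\lceil\sigma\rceil_A$ and $m_A:\mathsf{ChD}_A(\iota)$. If $R_\iota(n,m)$ and for every $i\in\mathbb{N}$ we have $R_\sigma(f\,i,(g_A\,\underline{i})_A)$, then $R_\sigma(\mathsf{ext}_\sigma\,f\,n,\;(\mathsf{ext}^T_{\sigma,A}\,g_A\,m_A)_A)$.
   Context: Metatheory: constructive Martin-Löf type theory without function extensionality. System T types: base $\iota$ and $\sigma\Rightarrow\tau$; standard closed terms with $\mathsf{zero},\mathsf{succ},\mathsf{rec}_\sigma,\lambda$, application; numerals $\underline0=\mathsf{zero}$, $\underline{n+1}=\mathsf{succ}\,\underline n$. Set interpretation $[\![\iota]\!]=\mathbb{N}$, $[\![\sigma\Rightarrow\tau]\!]=[\![\sigma]\!]\to[\![\tau]\!]$. Hereditarily extensional equality: $n\approx_\iota m$ iff $n=m$; $f\approx_{\sigma_1\Rightarrow\sigma_2}g$ iff $\forall x,y$, $x\approx_{\sigma_1}y\Rightarrow f\,x\approx_{\sigma_2}g\,y$. Dialogue trees $\mathcal{D}_{\mathbb N}\mathbb{N}$: inductive, constructors $\eta\,n$ and $\beta\,\varphi\,i$. Kleisli: $f^\sharp(\eta\,x)=f\,x$, $f^\sharp(\beta\,\varphi\,i)=\beta(\lambda o.f^\sharp(\varphi\,o))\,i$. $\mathcal{B}[\![\iota]\!]=\mathcal{D}_{\mathbb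 N}\mathbb{N}$, $\mathcal{B}[\![\sigma\Rightarrow\tau]\!]=\mathcal{B}[\![\sigma]\!]\to\mathcal{B}[\![\tau]\!]$. $\mathsf{ext}_\iota\,f\,d=f^\sharp\,d$, $\mathsf{ext}_{\sigma_1\Rightarrow\sigma_2}\,f\,d\,s=\mathsf{ext}_{\sigma_2}(\lambda x.f\,x\,s)\,d$. Internal trees: $\mathsf{ChD}_A(\sigma):=(\sigma\Rightarrow A)\Rightarrow((\iota\Rightarrow A)\Rightarrow\iota\Rightarrow A)\Rightarrow A$; $\eta_A:=\lambda z\,e\,b.\,e\,z$; $\beta_A:=\lambda\varphi\,x\,e\,b.\,b\,(\lambda y.\varphi\,y\,e\,b)\,x$; $K_A:=\lambda f\,d\,e'\,b'.\,d\,(\lambda x.f\,x\,e'\,b')\,b'$. $\lceil\iota\rceil_A=\mathsf{ChD}_A(\iota)$, $\lceil\sigma\Rightarrow\tau\rceil_A=\lceil\sigma\rceil_A\Rightarrow\lceil\tau\rceil_A$. $\mathsf{ext}^T_{\iota,A}:=K_A$, $\mathsf{ext}^T_{\sigma_1\Rightarrow\sigma_2,A}:=\lambda f\,d\,s.\mathsf{ext}^T_{\sigma_2,A}(\lambda x.f\,x\,s)\,d$ (closed terms of type $(\iota\Rightarrow\lceil\sigma\rceil_A)\Rightarrow\mathsf{ChD}_A(\iota)\Rightarrow\lceil\sigma\rceil_A$). Encoding $\mathsf{enc}_A(\eta\,z)=[\![\eta_A]\!]\,z$, $\mathsf{enc}_A(\beta\,\varphi\,x)=[\![\beta_A]\!](\mathsf{enc}_A\circ\varphi)\,x$.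 Logical relation, for $x\in\mathcal{B}[\![\sigma]\!]$ and $y$ a family of closed terms $y_A:\lceil\sigma\rceil_A$: $R_\iota(d,t)$ iff for all $A$, $\mathsf{enc}_A(d)\approx[\![t_A]\!]$; $R_{\sigma_1\Rightarrow\sigma_2}(f,g)$ iff for all $x\in\mathcal{B}[\![\sigma_1]\!]$ and families $y$ with $y_A:\lceil\sigma_1\rceil_A$, $R_{\sigma_1}(x,y)$ implies $R_{\sigma_2}(f\,x,(g_A\,y_A)_A)$. -}

module Defs where

open import Data.Nat using (ℕ; zero; suc)
open import Data.Unit using (⊤; tt)
open import Data.Product using (_×_; _,_)
open import Relation.Binary.PropositionalEquality using (_≡_)

infixr 5 _⇒_
data Ty : Set where
  ι   : Ty
  _⇒_ : Ty → Ty → Ty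

infixl 4 _▸_
data Ctx : Set where
  ε    : Ctx
  _▸_  : Ctx → Ty → Ctx

data _∋_ : Ctx → Ty → Set where
  here  : ∀ {Γ σ} → (Γ ▸ σ) ∋ σ
  there : ∀ {Γ σ τ} → Γ ∋ σ → (Γ ▸ τ) ∋ σ

infixl 6 _·_
data Tm (Γ : Ctx) : Ty → Set where
  var  : ∀ {σ} → Γ ∋ σ → Tm Γ σ
  Zero : Tm Γ ι
  Succ : Tm Γ (ι ⇒ ι)
  Rec  : ∀ σ → Tm Γ ((ι ⇒ σ ⇒ σ) ⇒ σ ⇒ ι ⇒ σ)
  lam  : ∀ {σ τ} → Tm (Γ ▸ σ) τ → Tm Γ (σ ⇒ τ)
  _·_  : ∀ {σ τ} → Tm Γ (σ ⇒ τ) → Tm Γ σ → Tm Γ τ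

num : ∀ {Γ} → ℕ → Tm Γ ι
num zero    = Zero
num (suc n) = Succ · num n

⟦_⟧ʸ : Ty → Set
⟦ ι ⟧ʸ     = ℕ
⟦ σ ⇒ τ ⟧ʸ = ⟦ σ ⟧ʸ → ⟦ τ ⟧ʸ

⟦_⟧ᶜ : Ctx → Set
⟦ ε ⟧ᶜ     = ⊤
⟦ Γ ▸ σ ⟧ᶜ = ⟦ Γ ⟧ᶜ × ⟦ σ ⟧ʸ

lookupEnv : ∀ {Γ σ} → Γ ∋ σ → ⟦ Γ ⟧ᶜ → ⟦ σ ⟧ʸ
lookupEnv here      (γ , x) = x
lookupEnv (there v) (γ , x) = lookupEnv v γ

rec : ∀ {X : Set} → (ℕ → X → X) → X → ℕ → X
rec f a zero    = a
rec f a (suc n) = f n (rec f a n)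

⟦_⟧ₑ : ∀ {Γ σ} → Tm Γ σ → ⟦ Γ ⟧ᶜ → ⟦ σ ⟧ʸ
⟦ var v ⟧ₑ γ = lookupEnv v γ
⟦ Zero ⟧ₑ γ  = zero
⟦ Succ ⟧ₑ γ  = suc
⟦ Rec σ ⟧ₑ γ = rec
⟦ lam t ⟧ₑ γ = λ x → ⟦ t ⟧ₑ (γ , x)
⟦ t · u ⟧ₑ γ = ⟦ t ⟧ₑ γ (⟦ u ⟧ₑ γ)

⟦_⟧ : ∀ {σ} → Tm ε σ → ⟦ σ ⟧ʸ
⟦ t ⟧ = ⟦ t ⟧ₑ tt

HEq : (σ : Ty) → ⟦ σ ⟧ʸ → ⟦ σ ⟧ʸ → Set
HEq ι       n m = n ≡ m
HEq (σ ⇒ τ) f g = ∀ x y → HEq σ x y → HEq τ (f x) (g y)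

-- dialogue trees D_ℕ ℕ
data D : Set where
  η : ℕ → D
  β : (ℕ → D) → ℕ → D

_♯ : (ℕ → D) → D → D
(f ♯) (η x)   = f x
(f ♯) (β φ i) = β (λ o → (f ♯) (φ o)) i

B⟦_⟧ : Ty → Set
B⟦ ι ⟧     = D
B⟦ σ ⇒ τ ⟧ = B⟦ σ ⟧ → B⟦ τ ⟧

ext : (σ : Ty) → (ℕ → B⟦ σ ⟧) → D → B⟦ σ ⟧
ext ι       f d   = (f ♯) d
ext (σ ⇒ τ) f d s = ext τ (λ x → f x s) d

-- internal (Church-encoded) dialogue trees
ChD : Ty → Ty → Ty
ChD A σ = (σ ⇒ A) ⇒ ((ι ⇒ A) ⇒ ι ⇒ A) ⇒ A

v0 : ∀ {Γ σ} → Tm (Γ ▸ σ) σ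
v0 = var here
v1 : ∀ {Γ σ τ} → Tm (Γ ▸ σ ▸ τ) σ
v1 = var (there here)
v2 : ∀ {Γ σ τ ρ} → Tm (Γ ▸ σ ▸ τ ▸ ρ) σ
v2 = var (there (there here))
v3 : ∀ {Γ σ τ ρ κ} → Tm (Γ ▸ σ ▸ τ ▸ ρ ▸ κ) σ
v3 = var (there (there (there here)))
v4 : ∀ {Γ σ τ ρ κ μ} → Tm (Γ ▸ σ ▸ τ ▸ ρ ▸ κ ▸ μ) σ
v4 = var (there (there (there (there here))))

-- η_A := λ z e b. e z
ηT : ∀ {Γ} (A : Ty) → Tm Γ (ι ⇒ ChD A ι)
ηT A = lam (lam (lam (v1 · v2)))

-- β_A := λ φ x e b. b (λ y. φ y e b) x
βT : ∀ {Γ} (A : Ty) → Tm Γ ((ι ⇒ ChD A ι) ⇒ ι ⇒ ChD A ι)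
βT A = lam (lam (lam (lam (v0 · lam (v4 · v0 · v2 · v1) · v2))))

-- K_A := λ f d e' b'. d (λ x. f x e' b') b'
KT : ∀ {Γ} (A : Ty) → Tm Γ ((ι ⇒ ChD A ι) ⇒ ChD A ι ⇒ ChD A ι)
KT A = lam (lam (lam (lam (v2 · lam (v4 · v0 · v2 · v1) · v0))))

⌈_⌉ : Ty → Ty → Ty
⌈ ι ⌉ A     = ChD A ι
⌈ σ ⇒ τ ⌉ A = ⌈ σ ⌉ A ⇒ ⌈ τ ⌉ A

-- ext^T_{σ,A} := K_A at ι; λ f d s. ext^T_{σ2,A} (λ x. f x s) d at σ1 ⇒ σ2
extT : ∀ {Γ} (σ A : Ty) → Tm Γ ((ι ⇒ ⌈ σ ⌉ A) ⇒ ChD A ι ⇒ ⌈ σ ⌉ A)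
extT ι       A = KT A
extT (σ ⇒ τ) A = lam (lam (lam (extT τ A · lam (v3 · v0 · v1) · v1)))

enc : (A : Ty) → D → ⟦ ChD A ι ⟧ʸ
enc A (η z)   = ⟦ ηT A ⟧ z
enc A (β φ x) = ⟦ βT A ⟧ (λ o → enc A (φ o)) x

Fam : Ty → Set
Fam σ = (A : Ty) → Tm ε (⌈ σ ⌉ A)

R : (σ : Ty) → B⟦ σ ⟧ → Fam σ → Set
R ι       d t = (A : Ty) → HEq (ChD A ι) (enc A d) ⟦ t A ⟧
R (σ ⇒ τ) f g = (x : B⟦ σ ⟧) (y : Fam σ) → R σ x y → R τ (f x) (λ A → g A · y A)

-- Everything is moved to the semantic side: R only depends on the terms through their
-- interpretations, so it suffices to relate ext σ f n to the denotation of extT σ A.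
-- By induction on σ this reduces to the base case, where ⟦K_A⟧ g m is
-- λ e b. m (λ x. g x e b) b; that this tracks the Kleisli extension is the fact
-- enc(f♯ d) e b ≈ enc d (λ x. enc (f x) e b) b, proved by induction on the tree d.
module Submission where

open import Defs
open import Data.Nat using (ℕ; zero; suc)
open import Data.Product using (_,_)
open import Relation.Binary.PropositionalEquality using (_≡_; refl; subst; cong)

HEq-sym : (σ : Ty) {x y : ⟦ σ ⟧ʸ} → HEq σ x y → HEq σ y x
HEq-sym ι       refl          = refl
HEq-sym (σ ⇒ τ) f≈g x y x≈y = HEq-sym τ (f≈g y x (HEq-sym σ x≈y))

HEq-trans : (σ : Ty) {x y z : ⟦ σ ⟧ʸ} → HEq σ x y → HEq σ y z → HEq σ x z
HEq-trans ι       refl refl         = refl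
HEq-trans (σ ⇒ τ) f≈g g≈h x z x≈z =
  HEq-trans τ (f≈g x z x≈z) (g≈h z z (HEq-trans σ (HEq-sym σ x≈z) x≈z))

HEq-reflˡ : (σ : Ty) {x y : ⟦ σ ⟧ʸ} → HEq σ x y → HEq σ x x
HEq-reflˡ σ x≈y = HEq-trans σ x≈y (HEq-sym σ x≈y)

enc-refl : (A : Ty) (d : D) → HEq (ChD A ι) (enc A d) (enc A d)
enc-refl A (η z)   e e' e≈e' b b' b≈b' = e≈e' z z refl
enc-refl A (β φ x) e e' e≈e' b b' b≈b' =
  b≈b' _ _ (λ { y .y refl → enc-refl A (φ y) e e' e≈e' b b' b≈b' }) x x refl

enc-♯ : (A : Ty) (f : ℕ → D) (d : D) (e : ⟦ ι ⇒ A ⟧ʸ) (b : ⟦ (ι ⇒ A) ⇒ ι ⇒ A ⟧ʸ) →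
        HEq (ι ⇒ A) e e → HEq ((ι ⇒ A) ⇒ ι ⇒ A) b b →
        HEq A (enc A ((f ♯) d) e b) (enc A d (λ x → enc A (f x) e b) b)
enc-♯ A f (η z)   e b e≈e b≈b = enc-refl A (f z) e e e≈e b b b≈b
enc-♯ A f (β φ i) e b e≈e b≈b =
  b≈b _ _ (λ { y .y refl → enc-♯ A f (φ y) e b e≈e b≈b }) i i refl

KT-correct : (A : Ty) {Γ : Ctx} (γ : ⟦ Γ ⟧ᶜ) (f : ℕ → D) (n : D)
             (g : ℕ → ⟦ ChD A ι ⟧ʸ) (m : ⟦ ChD A ι ⟧ʸ) →
             HEq (ChD A ι) (enc A n) m →
             ((x : ℕ) → HEq (ChD A ι) (enc A (f x)) (g x)) →
             HEq (ChD A ι) (enc A ((f ♯) n)) (⟦ KT A ⟧ₑ γ g m)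
KT-correct A γ f n g m n≈m f≈g e e' e≈e' b b' b≈b' =
  HEq-trans A (enc-♯ A f n e b (HEq-reflˡ (ι ⇒ A) e≈e') (HEq-reflˡ ((ι ⇒ A) ⇒ ι ⇒ A) b≈b'))
    (n≈m _ _ (λ { x .x refl → f≈g x e e' e≈e' b b' b≈b' }) b b' b≈b')

Rˢ : (σ : Ty) → B⟦ σ ⟧ → ((A : Ty) → ⟦ ⌈ σ ⌉ A ⟧ʸ) → Set
Rˢ ι       d s = (A : Ty) → HEq (ChD A ι) (enc A d) (s A)
Rˢ (σ ⇒ τ) f s = (x : B⟦ σ ⟧) (y : Fam σ) → R σ x y → Rˢ τ (f x) (λ A → s A ⟦ y A ⟧)

R⇒Rˢ : (σ : Ty) {x : B⟦ σ ⟧} {t : Fam σ} → R σ x t → Rˢ σ x (λ A → ⟦ t A ⟧)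
R⇒Rˢ ι       r       = r
R⇒Rˢ (σ ⇒ τ) r x y s = R⇒Rˢ τ (r x y s)

Rˢ⇒R : (σ : Ty) {x : B⟦ σ ⟧} {t : Fam σ} → Rˢ σ x (λ A → ⟦ t A ⟧) → R σ x t
Rˢ⇒R ι       r       = r
Rˢ⇒R (σ ⇒ τ) r x y s = Rˢ⇒R τ (r x y s)

⟦num⟧ : (i : ℕ) → ⟦ num {ε} i ⟧ ≡ i
⟦num⟧ zero    = refl
⟦num⟧ (suc i) = cong suc (⟦num⟧ i)

-- The environment varies with A and grows under the three binders of extT (σ ⇒ τ) A.
extT-correct : (σ : Ty) (Γ : Ty → Ctx) (γ : (A : Ty) → ⟦ Γ A ⟧ᶜ)
               (f : ℕ → B⟦ σ ⟧) (n : D)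
               (g : (A : Ty) → ℕ → ⟦ ⌈ σ ⌉ A ⟧ʸ) (m : (A : Ty) → ⟦ ChD A ι ⟧ʸ) →
               Rˢ ι n m →
               ((i : ℕ) → Rˢ σ (f i) (λ A → g A i)) →
               Rˢ σ (ext σ f n) (λ A → ⟦ extT σ A ⟧ₑ (γ A) (g A) (m A))
extT-correct ι Γ γ f n g m n≈m f≈g A =
  KT-correct A (γ A) f n (g A) (m A) (n≈m A) (λ x → f≈g x A)
extT-correct (σ ⇒ τ) Γ γ f n g m n≈m f≈g x y r =
  extT-correct τ (λ A → Γ A ▸ _ ▸ _ ▸ _) (λ A → ((γ A , g A) , m A) , ⟦ y A ⟧)
    (λ i → f i x) n (λ A i → g A i ⟦ y A ⟧) m n≈m (λ i → f≈g i x y r)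

lemma32 : (σ : Ty) (f : ℕ → B⟦ σ ⟧) (n : D)
          (g : (A : Ty) → Tm ε (ι ⇒ ⌈ σ ⌉ A)) (m : (A : Ty) → Tm ε (ChD A ι)) →
          R ι n m →
          ((i : ℕ) → R σ (f i) (λ A → g A · num i)) →
          R σ (ext σ f n) (λ A → extT σ A · g A · m A)
lemma32 σ f n g m n≈m f≈g =
  Rˢ⇒R σ (extT-correct σ (λ _ → ε) (λ _ → _) f n (λ A → ⟦ g A ⟧) (λ A → ⟦ m A ⟧) n≈m f≈gˢ)
  where
  f≈gˢ : (i : ℕ) → Rˢ σ (f i) (λ A → ⟦ g A ⟧ i)
  f≈gˢ i = subst (λ k → Rˢ σ (f i) (λ A → ⟦ g A ⟧ k)) (⟦num⟧ i) (R⇒Rˢ σ (f≈g i))
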